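{- Let $n \ge 1$ and $\sigma, \tau \in S_n$. If $\tau \leq_{\mathrm{c}} \sigma$ (cycle inclusion order), then $\tau \leq \sigma$ in the (strong) Bruhat order on $S_n$.
   Context: For $\sigma \in S_n$ and $\ell \ge 2$, let $C_\ell(\sigma)$ denote the set of $\ell$-cycles in the disjoint cycle decomposition of $\sigma$. The cycle inclusion order is defined by: $\tau \leq_{\mathrm{c}} \sigma$ if and only if $C_k(\tau) \subseteq C_k(\sigma)$ for all $k \ge 2$. Bruhat order is the standard (strong) Bruhat order on $S_n$, in which the identity is the minimum: $\tau \le \sigma$ if $\sigma$ can be obtained from $\tau$ by a sequence of steps, each of which swaps two values $i<j$ in the one-line notation of the current permutation where $i$ occurs to the left of $j$. -}

module Defs where

open import Data.Nat as ℕ using (ℕ; zero; suc)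
open import Data.Fin as Fin using (Fin; zero; suc; toℕ; fromℕ<)
open import Data.Fin.Permutation using (Permutation′; _⟨$⟩ʳ_; transpose)
open import Data.Product using (Σ; ∃; _×_; _,_)
open import Function.Definitions using (Injective)
open import Relation.Binary.PropositionalEquality using (_≡_)
open import Relation.Nullary using (yes; no)

Perm : ℕ → Set
Perm n = Permutation′ n

-- one-line notation: position p ↦ value w(p)
oneLine : ∀ {n} → Perm n → (Fin n → Fin n)
oneLine σ p = σ ⟨$⟩ʳ p

csuc : ∀ {m} → Fin (suc m) → Fin (suc m)
csuc {m} i with toℕ i ℕ.<? m
... | yes p = suc (fromℕ< p)
... | no _  = zero

-- c : Fin ℓ → Fin n is the ℓ-cycle (c 0  c 1 … c (ℓ-1)) of σ :
-- its entries are distinct and σ maps c i to c (i+1 mod ℓ).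
-- (A cycle written this way is determined up to rotation, and this
-- predicate is invariant under rotation, so it describes C_ℓ(σ).)
IsCycleOf : ∀ {n} (σ : Perm n) (ℓ : ℕ) → (Fin ℓ → Fin n) → Set
IsCycleOf σ zero    c = Injective _≡_ _≡_ c
IsCycleOf σ (suc m) c =
  Injective _≡_ _≡_ c × (∀ i → σ ⟨$⟩ʳ c i ≡ c (csuc i))

_≤c_ : ∀ {n} → Perm n → Perm n → Set
_≤c_ {n} τ σ = ∀ (k : ℕ) → 2 ℕ.≤ k →
  (c : Fin k → Fin n) → IsCycleOf τ k c → IsCycleOf σ k c

BruhatStep : ∀ {n} → (Fin n → Fin n) → (Fin n → Fin n) → Set
BruhatStep {n} w w' = Σ (Fin n) λ p → Σ (Fin n) λ q →
  p Fin.< q × w p Fin.< w q ×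
  (∀ r → w' r ≡ w (transpose p q ⟨$⟩ʳ r))

data BruhatChain {n} : (Fin n → Fin n) → (Fin n → Fin n) → Set where
  done : ∀ {w w'} → (∀ r → w r ≡ w' r) → BruhatChain w w'
  step : ∀ {w v w'} → BruhatStep w v → BruhatChain v w' → BruhatChain w w'

_≤B_ : ∀ {n} → Perm n → Perm n → Set
τ ≤B σ = BruhatChain (oneLine τ) (oneLine σ)

{-# OPTIONS --safe #-}
module Submission where

-- Each point moved by τ lies on a τ-cycle of length at least 2 (its orbit, cut off at the least
-- period), which by hypothesis is also a σ-cycle. Hence σ agrees with τ wherever τ moves a
-- point, and σ permutes the fixed points of τ. Now repair σ from the right: at the last
-- position m where σ differs from τ, τ fixes m, and both the position p of the value m in σ
-- and the value σ m are disagreement positions, hence smaller than m. Swapping positions p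
-- and m of σ gives σ′ agreeing with τ from m on, and σ is σ′ with the values σ m < m at
-- positions p < m exchanged, one Bruhat step up.

open import Defs
open import Data.Nat using (ℕ; zero; suc; _+_; _≤_; _<_; z≤n; s≤s; _<?_)
open import Data.Nat.Properties
  using ( n<1+n; +-suc; m≤n+m; ≤-refl; ≤-trans; <⇒≤; <⇒≤pred; <-irrefl; <-asym; <-cmp
        ; ≮⇒≥; ≤⇒≯; ≤∧≢⇒<; ≤∧≮⇒≡; m≤n⇒m<n∨m≡n; m≤n⇒∃[o]m+o≡n )
open import Data.Nat.GeneralisedArithmetic using (fold; fold-+)
open import Data.Fin as Fin using (Fin; zero; suc; toℕ; fromℕ; fromℕ<)
open import Data.Fin.Properties
  using (_≟_; toℕ-injective; toℕ<n; toℕ-fromℕ; toℕ-fromℕ<; toℕ-inject; pigeonhole; ¬∀⟶∃¬-smallest)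
open import Data.Fin.Permutation using (Permutation′; _⟨$⟩ʳ_; _⟨$⟩ˡ_; transpose; inverseʳ; _∘ₚ_)
import Data.Fin.Permutation.Components as PC
open import Data.Product using (∃; _×_; _,_; proj₁; proj₂)
open import Data.Sum as Sum using (_⊎_; inj₁; inj₂)
open import Function using (_∘_)
open import Function.Bundles using (Injection)
open import Function.Properties.Inverse using (↔⇒↣)
open import Relation.Binary.Definitions using (tri<; tri≈; tri>)
open import Relation.Binary.PropositionalEquality
open import Relation.Nullary using (¬_; Dec; yes; no; contradiction)
open import Relation.Nullary.Decidable using (¬?; decidable-stable; dec-true; dec-false)
open import Relation.Unary using (Pred; Decidable)

∃⇒∃-smallest : ∀ {p} (P : Pred ℕ p) → Decidable P →
               ∃ P → ∃ λ m → P m × (∀ {j} → j < m → ¬ P j)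
∃⇒∃-smallest P P? (k , Pk)
  with i , ¬¬Pi , below ← ¬∀⟶∃¬-smallest (suc k) (¬_ ∘ P ∘ toℕ) (¬? ∘ P? ∘ toℕ)
                           (λ never → never (fromℕ k) (subst P (sym (toℕ-fromℕ k)) Pk))
  = toℕ i , decidable-stable (P? (toℕ i)) ¬¬Pi , λ j<i →
      subst (¬_ ∘ P) (trans (toℕ-inject _) (toℕ-fromℕ< j<i)) (below (fromℕ< j<i))

module _ {n : ℕ} where

  ⟨$⟩ʳ-injective : (π : Permutation′ n) {x y : Fin n} → π ⟨$⟩ʳ x ≡ π ⟨$⟩ʳ y → x ≡ y
  ⟨$⟩ʳ-injective π = Injection.injective (↔⇒↣ π)

  transpose-matchˡ : (i j : Fin n) → PC.transpose i j i ≡ j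
  transpose-matchˡ i j rewrite dec-true (i ≟ i) refl = refl

  transpose-matchʳ : (i j : Fin n) → PC.transpose i j j ≡ i
  transpose-matchʳ i j with j ≟ i
  ... | yes j≡i = j≡i
  ... | no _ rewrite dec-true (j ≟ j) refl = refl

  transpose-other : {i j k : Fin n} → k ≢ i → k ≢ j → PC.transpose i j k ≡ k
  transpose-other {i} {j} {k} k≢i k≢j rewrite dec-false (k ≟ i) k≢i | dec-false (k ≟ j) k≢j = refl

toℕ-csuc : ∀ {m} (i : Fin (suc m)) → toℕ i < m → toℕ (csuc i) ≡ suc (toℕ i)
toℕ-csuc {m} i i<m with toℕ i <? m
... | yes i<m′ = cong suc (toℕ-fromℕ< i<m′)
... | no  i≮m  = contradiction i<m i≮m

csuc-last : ∀ {m} (i : Fin (suc m)) → ¬ toℕ i < m → csuc i ≡ zero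
csuc-last {m} i i≮m with toℕ i <? m
... | yes i<m = contradiction i<m i≮m
... | no  _   = refl

module _ {n : ℕ} (τ : Perm n) where

  orbit : Fin n → ℕ → Fin n
  orbit x k = fold x (τ ⟨$⟩ʳ_) k

  orbit-cancel : ∀ k {y z} → orbit y k ≡ orbit z k → y ≡ z
  orbit-cancel zero    y≡z = y≡z
  orbit-cancel (suc k) eq  = orbit-cancel k (⟨$⟩ʳ-injective τ eq)

  orbit-repeat : ∀ x i d → orbit x i ≡ orbit x (suc i + d) → orbit x (suc d) ≡ x
  orbit-repeat x i d eq = sym (orbit-cancel i (begin
    orbit x i                  ≡⟨ eq ⟩
    orbit x (suc i + d)        ≡⟨ cong (orbit x) (sym (+-suc i d)) ⟩
    orbit x (i + suc d)        ≡⟨ fold-+ x _ i ⟩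
    orbit (orbit x (suc d)) i  ∎))
    where open ≡-Reasoning

  orbit-periodic : ∀ x → ∃ λ d → orbit x (suc d) ≡ x
  orbit-periodic x
    with i , j , i<j , eq ← pigeonhole (n<1+n n) (orbit x ∘ toℕ)
    with d , i+d≡j ← m≤n⇒∃[o]m+o≡n i<j
    = d , orbit-repeat x (toℕ i) d (trans eq (cong (orbit x) (sym i+d≡j)))

  orbit-isCycle : ∀ x → ∃ λ m → IsCycleOf τ (suc m) (orbit x ∘ toℕ)
  orbit-isCycle x
    with m , period , minimal ←
           ∃⇒∃-smallest (λ k → orbit x (suc k) ≡ x) (λ k → orbit x (suc k) ≟ x) (orbit-periodic x)
    = m , injective , shift
    where
    distinct : ∀ {i j} → i < j → j ≤ m → orbit x i ≢ orbit x j
    distinct {i} i<j j≤m eq with d , refl ← m≤n⇒∃[o]m+o≡n i<j =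
      minimal (≤-trans (s≤s (m≤n+m d i)) j≤m) (orbit-repeat x i d eq)

    injective : ∀ {a b} → orbit x (toℕ a) ≡ orbit x (toℕ b) → a ≡ b
    injective {a} {b} eq with <-cmp (toℕ a) (toℕ b)
    ... | tri< a<b _ _ = contradiction eq (distinct a<b (<⇒≤pred (toℕ<n b)))
    ... | tri≈ _ a≡b _ = toℕ-injective a≡b
    ... | tri> _ _ b<a = contradiction (sym eq) (distinct b<a (<⇒≤pred (toℕ<n a)))

    shift : ∀ i → τ ⟨$⟩ʳ orbit x (toℕ i) ≡ orbit x (toℕ (csuc i))
    shift i with toℕ i <? m
    ... | yes i<m = cong (orbit x) (sym (toℕ-csuc i i<m))
    ... | no  i≮m = begin
      τ ⟨$⟩ʳ orbit x (toℕ i)  ≡⟨ cong (orbit x ∘ suc) (≤∧≮⇒≡ (<⇒≤pred (toℕ<n i)) i≮m) ⟩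
      orbit x (suc m)          ≡⟨ period ⟩
      x                        ≡⟨ cong (orbit x ∘ toℕ) (sym (csuc-last i i≮m)) ⟩
      orbit x (toℕ (csuc i))   ∎
      where open ≡-Reasoning

AgreeOnSupport : ∀ {n} → Perm n → Perm n → Set
AgreeOnSupport {n} τ σ = ∀ (x : Fin n) → τ ⟨$⟩ʳ x ≡ x ⊎ σ ⟨$⟩ʳ x ≡ τ ⟨$⟩ʳ x

≤c⇒agreeOnSupport : ∀ {n} {τ σ : Perm n} → τ ≤c σ → AgreeOnSupport τ σ
≤c⇒agreeOnSupport {τ = τ} {σ} τ≤cσ x with orbit-isCycle τ x
... | zero  , _ , shift          = inj₁ (shift zero)
... | suc m , cycle@(_ , shift) = inj₂ (begin
  σ ⟨$⟩ʳ x          ≡⟨ proj₂ (τ≤cσ (2 + m) (s≤s (s≤s z≤n)) _ cycle) zero ⟩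
  orbit τ x 1       ≡⟨ shift zero ⟨
  τ ⟨$⟩ʳ x          ∎)
  where open ≡-Reasoning

AgreeFrom : ∀ {n} → ℕ → Perm n → Perm n → Set
AgreeFrom {n} b σ τ = ∀ (x : Fin n) → b ≤ toℕ x → σ ⟨$⟩ʳ x ≡ τ ⟨$⟩ʳ x

agreeFrom-pred : ∀ {n b} {σ τ : Perm n} {m : Fin n} → toℕ m ≡ b → σ ⟨$⟩ʳ m ≡ τ ⟨$⟩ʳ m →
                 AgreeFrom (suc b) σ τ → AgreeFrom b σ τ
agreeFrom-pred {σ = σ} {τ} refl σm≡τm agree-above x m≤x with m≤n⇒m<n∨m≡n m≤x
... | inj₁ m<x = agree-above x m<x
... | inj₂ m≡x = subst (λ z → σ ⟨$⟩ʳ z ≡ τ ⟨$⟩ʳ z) (toℕ-injective m≡x) σm≡τm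

BruhatChain-snoc : ∀ {n} {u v w : Fin n → Fin n} →
                   BruhatChain u v → BruhatStep v w → BruhatChain u w
BruhatChain-snoc (done u≗v) (p , q , p<q , vp<vq , w≗v∘t) =
  step (p , q , p<q , subst₂ Fin._<_ (sym (u≗v p)) (sym (u≗v q)) vp<vq ,
        λ r → trans (w≗v∘t r) (sym (u≗v _)))
       (done λ _ → refl)
BruhatChain-snoc (step s chain) s′ = step s (BruhatChain-snoc chain s′)

module _ {n : ℕ} {τ σ : Perm n} (agree : AgreeOnSupport τ σ) where

  disagreement⇒fixed : ∀ {x} → σ ⟨$⟩ʳ x ≢ τ ⟨$⟩ʳ x → τ ⟨$⟩ʳ x ≡ x
  disagreement⇒fixed {x} σx≢τx with agree x
  ... | inj₁ τx≡x = τx≡x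
  ... | inj₂ σx≡τx = contradiction σx≡τx σx≢τx

  preimage-fixed : ∀ {x} → τ ⟨$⟩ʳ x ≡ x → τ ⟨$⟩ʳ (σ ⟨$⟩ˡ x) ≡ σ ⟨$⟩ˡ x
  preimage-fixed {x} τx≡x with agree (σ ⟨$⟩ˡ x)
  ... | inj₁ τp≡p = τp≡p
  ... | inj₂ σp≡τp = begin
    τ ⟨$⟩ʳ p  ≡⟨ σp≡τp ⟨
    σ ⟨$⟩ʳ p  ≡⟨ inverseʳ σ ⟩
    x         ≡⟨ p≡x ⟨
    p         ∎
    where
    open ≡-Reasoning
    p = σ ⟨$⟩ˡ x
    p≡x : p ≡ x
    p≡x = ⟨$⟩ʳ-injective τ (trans (sym σp≡τp) (trans (inverseʳ σ) (sym τx≡x)))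

  image-fixed : ∀ {x} → τ ⟨$⟩ʳ x ≡ x → τ ⟨$⟩ʳ (σ ⟨$⟩ʳ x) ≡ σ ⟨$⟩ʳ x
  image-fixed {x} τx≡x with agree (τ ⟨$⟩ˡ (σ ⟨$⟩ʳ x))
  ... | inj₁ τz≡z = trans (cong (τ ⟨$⟩ʳ_) (sym z≡σx)) (inverseʳ τ)
    where
    z≡σx : τ ⟨$⟩ˡ (σ ⟨$⟩ʳ x) ≡ σ ⟨$⟩ʳ x
    z≡σx = trans (sym τz≡z) (inverseʳ τ)
  ... | inj₂ σz≡τz = begin
    τ ⟨$⟩ʳ (σ ⟨$⟩ʳ x)  ≡⟨ cong (τ ⟨$⟩ʳ_) σx≡x ⟩
    τ ⟨$⟩ʳ x           ≡⟨ τx≡x ⟩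
    x                  ≡⟨ σx≡x ⟨
    σ ⟨$⟩ʳ x           ∎
    where
    open ≡-Reasoning
    z≡x : τ ⟨$⟩ˡ (σ ⟨$⟩ʳ x) ≡ x
    z≡x = ⟨$⟩ʳ-injective σ (trans σz≡τz (inverseʳ τ))
    σx≡x : σ ⟨$⟩ʳ x ≡ x
    σx≡x = trans (sym (inverseʳ τ)) (trans (cong (τ ⟨$⟩ʳ_) z≡x) τx≡x)

  agreeOnSupport-swap : ∀ {i j} → τ ⟨$⟩ʳ i ≡ i → τ ⟨$⟩ʳ j ≡ j →
                        AgreeOnSupport τ (transpose i j ∘ₚ σ)
  agreeOnSupport-swap {i} {j} τi≡i τj≡j x = by-cases (x ≟ i) (x ≟ j)
    where
    by-cases : Dec (x ≡ i) → Dec (x ≡ j) →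
               τ ⟨$⟩ʳ x ≡ x ⊎ σ ⟨$⟩ʳ PC.transpose i j x ≡ τ ⟨$⟩ʳ x
    by-cases (yes refl) _          = inj₁ τi≡i
    by-cases (no _)     (yes refl) = inj₁ τj≡j
    by-cases (no x≢i)   (no x≢j)   =
      Sum.map₂ (trans (cong (σ ⟨$⟩ʳ_) (transpose-other x≢i x≢j))) (agree x)

  last-disagreement-bounds : ∀ {m} → AgreeFrom (suc (toℕ m)) σ τ → σ ⟨$⟩ʳ m ≢ τ ⟨$⟩ʳ m →
                             toℕ (σ ⟨$⟩ˡ m) < toℕ m × toℕ (σ ⟨$⟩ʳ m) < toℕ m
  last-disagreement-bounds {m} agree-above σm≢τm =
    below-m (λ σp≡τp → p≢m (trans (sym τp≡p) (trans (sym σp≡τp) (inverseʳ σ)))) p≢m ,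
    below-m (λ σy≡τy → y≢m (⟨$⟩ʳ-injective σ (trans σy≡τy τy≡y))) y≢m
    where
    p y : Fin n
    p = σ ⟨$⟩ˡ m
    y = σ ⟨$⟩ʳ m
    τm≡m : τ ⟨$⟩ʳ m ≡ m
    τm≡m = disagreement⇒fixed σm≢τm
    τp≡p : τ ⟨$⟩ʳ p ≡ p
    τp≡p = preimage-fixed τm≡m
    τy≡y : τ ⟨$⟩ʳ y ≡ y
    τy≡y = image-fixed τm≡m
    p≢m : p ≢ m
    p≢m p≡m = σm≢τm (trans (cong (σ ⟨$⟩ʳ_) (sym p≡m)) (trans (inverseʳ σ) (sym τm≡m)))
    y≢m : y ≢ m
    y≢m y≡m = σm≢τm (trans y≡m (sym τm≡m))
    below-m : ∀ {x} → σ ⟨$⟩ʳ x ≢ τ ⟨$⟩ʳ x → x ≢ m → toℕ x < toℕ m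
    below-m {x} σx≢τx x≢m = ≤∧≢⇒< (≮⇒≥ (σx≢τx ∘ agree-above x)) (x≢m ∘ toℕ-injective)

  swap-step : ∀ {b m} → toℕ m ≡ b → AgreeFrom (suc b) σ τ → σ ⟨$⟩ʳ m ≢ τ ⟨$⟩ʳ m →
              ∃ λ σ′ → AgreeOnSupport τ σ′ × AgreeFrom b σ′ τ × BruhatStep (oneLine σ′) (oneLine σ)
  swap-step {m = m} refl agree-above σm≢τm =
    σ′ , agreeOnSupport-swap τm≡m (preimage-fixed τm≡m) ,
    agreeFrom-pred {σ = σ′} {τ} refl (trans σ′m≡m (sym τm≡m)) σ′-agree-above ,
    (p , m , p<m , subst₂ Fin._<_ (sym σ′p≡σm) (sym σ′m≡m) σm<m ,
     λ r → cong (σ ⟨$⟩ʳ_) (sym (PC.transpose-inverse m p)))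
    where
    p : Fin n
    p = σ ⟨$⟩ˡ m
    σ′ : Perm n
    σ′ = transpose m p ∘ₚ σ
    τm≡m : τ ⟨$⟩ʳ m ≡ m
    τm≡m = disagreement⇒fixed σm≢τm
    p<m : toℕ p < toℕ m
    p<m = proj₁ (last-disagreement-bounds agree-above σm≢τm)
    σm<m : toℕ (σ ⟨$⟩ʳ m) < toℕ m
    σm<m = proj₂ (last-disagreement-bounds agree-above σm≢τm)
    σ′p≡σm : σ′ ⟨$⟩ʳ p ≡ σ ⟨$⟩ʳ m
    σ′p≡σm = cong (σ ⟨$⟩ʳ_) (transpose-matchʳ m p)
    σ′m≡m : σ′ ⟨$⟩ʳ m ≡ m
    σ′m≡m = trans (cong (σ ⟨$⟩ʳ_) (transpose-matchˡ m p)) (inverseʳ σ)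
    σ′-agree-above : AgreeFrom (suc (toℕ m)) σ′ τ
    σ′-agree-above x m<x = trans (cong (σ ⟨$⟩ʳ_) (transpose-other x≢m x≢p)) (agree-above x m<x)
      where
      x≢m : x ≢ m
      x≢m refl = <-irrefl refl m<x
      x≢p : x ≢ p
      x≢p refl = <-asym p<m m<x

module _ {n : ℕ} (τ : Perm n) where

  agreeOnSupport⇒≤B : ∀ b σ → b ≤ n → AgreeOnSupport τ σ → AgreeFrom b σ τ → τ ≤B σ
  agreeOnSupport⇒≤B zero    _ _   _     agree-from = done (λ x → sym (agree-from x z≤n))
  agreeOnSupport⇒≤B (suc b) σ b<n agree agree-from
    with σ ⟨$⟩ʳ fromℕ< b<n ≟ τ ⟨$⟩ʳ fromℕ< b<n
  ... | yes σb≡τb =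
    agreeOnSupport⇒≤B b σ (<⇒≤ b<n) agree
      (agreeFrom-pred {σ = σ} {τ} (toℕ-fromℕ< b<n) σb≡τb agree-from)
  ... | no σb≢τb
    with σ′ , agree′ , agree-from′ , σ′⋖σ ←
           swap-step {τ = τ} {σ} agree (toℕ-fromℕ< b<n) agree-from σb≢τb
    = BruhatChain-snoc (agreeOnSupport⇒≤B b σ′ (<⇒≤ b<n) agree′ agree-from′) σ′⋖σ

proposition3p4 : (n : ℕ) → 1 ≤ n → (σ τ : Perm n) → τ ≤c σ → τ ≤B σ
proposition3p4 n _ σ τ τ≤cσ =
  agreeOnSupport⇒≤B τ n σ ≤-refl (≤c⇒agreeOnSupport {τ = τ} {σ} τ≤cσ)
    (λ x n≤x → contradiction (toℕ<n x) (≤⇒≯ n≤x))
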